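{- Let $C_0, C_1, \ldots, C_k$ be finite chains and suppose $L = C_0 ]_{a_1}^{b_1} C_1 ]_{a_2}^{b_2} C_2 \cdots ]_{a_k}^{b_k} C_k$ is an iterated adjunct sum of them. Then $\operatorname{Dim}(L) \leq k+1$.
   Context: Adjunct sum: for disjoint lattices $L_1,L_2$ and $a<b$ in $L_1$ with $a \not\prec b$, $L_1 ]^b_a L_2$ is the set $L_1 \cup L_2$ with $x \leq y$ iff either $x,y\in L_1$ and $x\leq y$ in $L_1$; or $x,y\in L_2$ and $x\leq y$ in $L_2$; or $x\in L_1$, $y\in L_2$ and $x \leq a$ in $L_1$; or $x \in L_2$, $y \in L_1$ and $b \leq y$ in $L_1$; it is a lattice. The expression $C_0 ]_{a_1}^{b_1} C_1 \cdots ]_{a_k}^{b_k} C_k$ is evaluated left to right, each $(a_i,b_i)$ being a pair $a_i<b_i$, $a_i\not\prec b_i$, in the lattice built so far. The dimension $\operatorname{Dim}(P)$ of a finite poset $P$ is the least number of linear extensions of its order whose intersection is exactly its order. -}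

module Defs where

open import Data.Nat using (ℕ; suc)
import Data.Nat as ℕ
open import Data.Fin using (Fin)
import Data.Fin as F
open import Data.Sum using (_⊎_; inj₁; inj₂)
open import Data.Product using (Σ; _×_; ∃)
open import Relation.Nullary using (¬_)
open import Relation.Binary.PropositionalEquality using (_≡_)

record Order : Set₁ where
  field
    Carrier : Set
    _≤_     : Carrier → Carrier → Set

open Order public

Lt : (L : Order) → Carrier L → Carrier L → Set
Lt L x y = _≤_ L x y × ¬ (x ≡ y)

Covers : (L : Order) → Carrier L → Carrier L → Set
Covers L a b = Lt L a b × ¬ (Σ (Carrier L) λ c → Lt L a c × Lt L c b)

chain : ℕ → Order
chain n = record { Carrier = Fin n ; _≤_ = F._≤_ }

adj : (L₁ : Order) → Carrier L₁ → Carrier L₁ → Order → Order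
adj L₁ a b L₂ = record { Carrier = Carrier L₁ ⊎ Carrier L₂ ; _≤_ = R }
  where
  R : Carrier L₁ ⊎ Carrier L₂ → Carrier L₁ ⊎ Carrier L₂ → Set
  R (inj₁ x) (inj₁ y) = _≤_ L₁ x y
  R (inj₂ x) (inj₂ y) = _≤_ L₂ x y
  R (inj₁ x) (inj₂ y) = _≤_ L₁ x a
  R (inj₂ x) (inj₁ y) = _≤_ L₁ b y

-- IterChainSum k L : L = C₀ ]^{b₁}_{a₁} C₁ ⋯ ]^{b_k}_{a_k} C_k for finite chains Cᵢ,
-- evaluated left to right, each (aᵢ,bᵢ) with aᵢ < bᵢ, aᵢ ⊀ bᵢ in the lattice built so far.
data IterChainSum : ℕ → Order → Set₁ where
  base : (n : ℕ) → IterChainSum 0 (chain n)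
  step : {k : ℕ} {L : Order} → IterChainSum k L →
         (a b : Carrier L) → Lt L a b → ¬ Covers L a b →
         (m : ℕ) → IterChainSum (suc k) (adj L a b (chain m))

record IsLinearExtension (L : Order) (R : Carrier L → Carrier L → Set) : Set where
  field
    refl    : ∀ x → R x x
    antisym : ∀ x y → R x y → R y x → x ≡ y
    trans   : ∀ x y z → R x y → R y z → R x z
    total   : ∀ x y → R x y ⊎ R y x
    extends : ∀ x y → _≤_ L x y → R x y

Realizer : Order → ℕ → Set₁
Realizer L t =
  Σ (Fin t → Carrier L → Carrier L → Set) λ R →
    ((i : Fin t) → IsLinearExtension L (R i)) ×
    (∀ x y → (_≤_ L x y → ∀ i → R i x y) × ((∀ i → R i x y) → _≤_ L x y))

DimLE : Order → ℕ → Set₁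
DimLE L d = Σ ℕ λ t → (t ℕ.≤ d) × Realizer L t

{-# OPTIONS --safe #-}
-- Induction on k, carrying a realizer by k + 1 decidable linear extensions. Given
-- one, R₀, …, R_k, of L, a realizer of L ]^b_a C is obtained by inserting C
-- immediately above a in every Rᵢ, and adding one more extension: R₀ with the
-- up-set ↑b of L moved to the top and C inserted just below it. The first k + 1
-- extensions separate C from every x ≰ a lying below it, the extra one separates
-- C from every y ≱ b lying above it; inside L and inside C nothing changes.
-- Decidability of the Rᵢ is what makes the insertions total and lets x ≤ a be
-- recovered from the double negations ¬ ¬ Rᵢ x a.
module Submission where

open import Defs
open import Data.Nat using (ℕ; suc)
open import Data.Nat.Properties using (≤-refl)
open import Data.Fin using (Fin; zero; suc)
import Data.Fin as F
import Data.Fin.Properties as FP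
open import Data.Sum using (_⊎_; inj₁; inj₂)
import Data.Sum as Sum
open import Data.Product using (_×_; _,_; proj₁)
open import Data.Empty using (⊥-elim)
open import Function using (id; const; _∘_)
open import Level using (0ℓ)
open import Relation.Binary using (Rel)
open import Relation.Unary using (Pred)
open import Relation.Nullary using (¬_; Dec; yes; no)
open import Relation.Nullary.Decidable
  using (map′; decidable-stable; ¬?; _×-dec_; _→-dec_)
open import Relation.Binary.PropositionalEquality using (_≡_; cong)

open IsLinearExtension

UpClosed : {A : Set} → Rel A 0ℓ → Pred A 0ℓ → Set
UpClosed R U = ∀ x y → R x y → U x → U y

-- R restricted to the complement of U, followed by R restricted to U.
UpSetOnTop : {A : Set} → Rel A 0ℓ → Pred A 0ℓ → Rel A 0ℓ
UpSetOnTop R U x y = (U x → U y) × ((U y → U x) → R x y)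

UpSetOnTop-upClosed : {A : Set} {R : Rel A 0ℓ} {U : Pred A 0ℓ} → UpClosed (UpSetOnTop R U) U
UpSetOnTop-upClosed x y = proj₁

UpSetOnTop-dec : {A : Set} {R : Rel A 0ℓ} {U : Pred A 0ℓ} →
                 (∀ x → Dec (U x)) → (∀ x y → Dec (R x y)) → ∀ x y → Dec (UpSetOnTop R U x y)
UpSetOnTop-dec U? R? x y = (U? x →-dec U? y) ×-dec ((U? y →-dec U? x) →-dec R? x y)

module _ {L : Order} {R : Rel (Carrier L) 0ℓ} {U : Pred (Carrier L) 0ℓ}
         (U? : ∀ x → Dec (U x)) where

  UpSetOnTop-isLinearExtension : IsLinearExtension L R → UpClosed (_≤_ L) U →
                                 IsLinearExtension L (UpSetOnTop R U)
  UpSetOnTop-isLinearExtension lin U-up = record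
    { refl    = λ x → id , λ _ → refl lin x
    ; antisym = λ x y (p , p′) (q , q′) → antisym lin x y (p′ q) (q′ p)
    ; trans   = λ x y z (p , p′) (q , q′) →
        (q ∘ p) , λ h → trans lin x y z (p′ (h ∘ q)) (q′ (p ∘ h))
    ; total   = total′
    ; extends = λ x y x≤y → U-up x y x≤y , λ _ → extends lin x y x≤y
    }
    where
    total′ : ∀ x y → UpSetOnTop R U x y ⊎ UpSetOnTop R U y x
    total′ x y with U? x | U? y
    ... | yes ux | yes uy =
      Sum.map (λ r → const uy , const r) (λ r → const ux , const r) (total lin x y)
    ... | no ¬ux | no ¬uy =
      Sum.map (λ r → ⊥-elim ∘ ¬ux , const r) (λ r → ⊥-elim ∘ ¬uy , const r) (total lin x y)
    ... | yes ux | no ¬uy = inj₂ (⊥-elim ∘ ¬uy , λ h → ⊥-elim (¬uy (h ux)))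
    ... | no ¬ux | yes uy = inj₁ (⊥-elim ∘ ¬ux , λ h → ⊥-elim (¬ux (h uy)))

InsertAtCut : {A B : Set} → Rel A 0ℓ → Pred A 0ℓ → Rel B 0ℓ → Rel (A ⊎ B) 0ℓ
InsertAtCut R U S (inj₁ x) (inj₁ y) = R x y
InsertAtCut R U S (inj₂ c) (inj₂ d) = S c d
InsertAtCut R U S (inj₁ x) (inj₂ c) = ¬ U x
InsertAtCut R U S (inj₂ c) (inj₁ y) = U y

InsertAtCut-dec : {A B : Set} {R : Rel A 0ℓ} {U : Pred A 0ℓ} {S : Rel B 0ℓ} →
                  (∀ x → Dec (U x)) → (∀ x y → Dec (R x y)) → (∀ c d → Dec (S c d)) →
                  ∀ x y → Dec (InsertAtCut R U S x y)
InsertAtCut-dec U? R? S? (inj₁ x) (inj₁ y) = R? x y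
InsertAtCut-dec U? R? S? (inj₂ c) (inj₂ d) = S? c d
InsertAtCut-dec U? R? S? (inj₁ x) (inj₂ c) = ¬? (U? x)
InsertAtCut-dec U? R? S? (inj₂ c) (inj₁ y) = U? y

module _ {L₁ L₂ : Order} {R : Rel (Carrier L₁) 0ℓ} {U : Pred (Carrier L₁) 0ℓ}
         {S : Rel (Carrier L₂) 0ℓ} (U? : ∀ x → Dec (U x)) where

  InsertAtCut-isLinearExtension :
    {a b : Carrier L₁} → IsLinearExtension L₁ R → IsLinearExtension L₂ S →
    UpClosed R U → ¬ U a → U b → IsLinearExtension (adj L₁ a b L₂) (InsertAtCut R U S)
  InsertAtCut-isLinearExtension {a} {b} linR linS U-up ¬Ua Ub = record
    { refl = refl′ ; antisym = antisym′ ; trans = trans′ ; total = total′ ; extends = extends′ }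
    where
    T : Rel (Carrier L₁ ⊎ Carrier L₂) 0ℓ
    T = InsertAtCut R U S

    refl′ : ∀ x → T x x
    refl′ (inj₁ x) = refl linR x
    refl′ (inj₂ c) = refl linS c

    antisym′ : ∀ x y → T x y → T y x → x ≡ y
    antisym′ (inj₁ x) (inj₁ y) p q = cong inj₁ (antisym linR x y p q)
    antisym′ (inj₂ c) (inj₂ d) p q = cong inj₂ (antisym linS c d p q)
    antisym′ (inj₁ x) (inj₂ c) ¬Ux Ux = ⊥-elim (¬Ux Ux)
    antisym′ (inj₂ c) (inj₁ y) Uy ¬Uy = ⊥-elim (¬Uy Uy)

    trans′ : ∀ x y z → T x y → T y z → T x z
    trans′ (inj₁ x) (inj₁ y) (inj₁ z) p q = trans linR x y z p q
    trans′ (inj₁ x) (inj₁ y) (inj₂ c) p ¬Uy = ¬Uy ∘ U-up x y p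
    trans′ (inj₁ x) (inj₂ c) (inj₁ z) ¬Ux Uz with total linR x z
    ... | inj₁ r = r
    ... | inj₂ r = ⊥-elim (¬Ux (U-up z x r Uz))
    trans′ (inj₁ x) (inj₂ c) (inj₂ d) ¬Ux _ = ¬Ux
    trans′ (inj₂ c) (inj₁ y) (inj₁ z) Uy q = U-up y z q Uy
    trans′ (inj₂ c) (inj₁ y) (inj₂ d) Uy ¬Uy = ⊥-elim (¬Uy Uy)
    trans′ (inj₂ c) (inj₂ d) (inj₁ z) _ Uz = Uz
    trans′ (inj₂ c) (inj₂ d) (inj₂ e) p q = trans linS c d e p q

    total′ : ∀ x y → T x y ⊎ T y x
    total′ (inj₁ x) (inj₁ y) = total linR x y
    total′ (inj₂ c) (inj₂ d) = total linS c d
    total′ (inj₁ x) (inj₂ c) with U? x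
    ... | yes Ux = inj₂ Ux
    ... | no ¬Ux = inj₁ ¬Ux
    total′ (inj₂ c) (inj₁ y) with U? y
    ... | yes Uy = inj₁ Uy
    ... | no ¬Uy = inj₂ ¬Uy

    extends′ : ∀ x y → _≤_ (adj L₁ a b L₂) x y → T x y
    extends′ (inj₁ x) (inj₁ y) x≤y = extends linR x y x≤y
    extends′ (inj₂ c) (inj₂ d) c≤d = extends linS c d c≤d
    extends′ (inj₁ x) (inj₂ c) x≤a = ¬Ua ∘ U-up x a (extends linR x a x≤a)
    extends′ (inj₂ c) (inj₁ y) b≤y = U-up b y (extends linR b y b≤y) Ub

record DecRealizer (L : Order) (t : ℕ) : Set₁ where
  field
    R        : Fin t → Rel (Carrier L) 0ℓ
    R?       : ∀ i x y → Dec (R i x y)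
    linear   : ∀ i → IsLinearExtension L (R i)
    reflects : ∀ x y → (∀ i → R i x y) → _≤_ L x y

  realizer : Realizer L t
  realizer = R , linear , λ x y → (λ x≤y i → extends (linear i) x y x≤y) , reflects x y

  _≤?_ : ∀ x y → Dec (_≤_ L x y)
  x ≤? y = map′ (reflects x y) (λ x≤y i → extends (linear i) x y x≤y) (FP.all? λ i → R? i x y)

  ≤-upClosed : ∀ z → UpClosed (_≤_ L) (_≤_ L z)
  ≤-upClosed z x y x≤y z≤x =
    reflects z y λ i → trans (linear i) z x y (extends (linear i) z x z≤x) (extends (linear i) x y x≤y)

  ≤-reflexive : ∀ x → _≤_ L x x
  ≤-reflexive x = reflects x x λ i → refl (linear i) x

  R-irreflexive : ∀ {x y} i → Lt L x y → ¬ R i y x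
  R-irreflexive {x} {y} i (x≤y , x≢y) Ryx = x≢y (antisym (linear i) x y (extends (linear i) x y x≤y) Ryx)

chainDecRealizer : ∀ n → DecRealizer (chain n) 1
chainDecRealizer n = record
  { R        = λ _ → F._≤_
  ; R?       = λ _ → F._≤?_
  ; linear   = λ _ → record
      { refl    = λ _ → FP.≤-refl
      ; antisym = λ _ _ → FP.≤-antisym
      ; trans   = λ _ _ _ → FP.≤-trans
      ; total   = FP.≤-total
      ; extends = λ _ _ → id
      }
  ; reflects = λ _ _ h → h zero
  }

adjDecRealizer : ∀ {t} {L₁ L₂ : Order} {a b : Carrier L₁} →
                 DecRealizer L₁ (suc t) → Lt L₁ a b → DecRealizer L₂ 1 →
                 DecRealizer (adj L₁ a b L₂) (suc (suc t))
adjDecRealizer {t} {L₁} {L₂} {a} {b} 𝓡 a<b 𝓢 = record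
  { R = R′ ; R? = R′? ; linear = linear′ ; reflects = reflects′ }
  where
  open DecRealizer 𝓡
  module 𝓢 = DecRealizer 𝓢

  ↑b : Pred (Carrier L₁) 0ℓ
  ↑b = _≤_ L₁ b

  ¬≤a : Fin (suc t) → Pred (Carrier L₁) 0ℓ
  ¬≤a i y = ¬ R i y a

  R′ : Fin (suc (suc t)) → Rel (Carrier L₁ ⊎ Carrier L₂) 0ℓ
  R′ zero    = InsertAtCut (UpSetOnTop (R zero) ↑b) ↑b (𝓢.R zero)
  R′ (suc i) = InsertAtCut (R i) (¬≤a i) (𝓢.R zero)

  R′? : ∀ i x y → Dec (R′ i x y)
  R′? zero    = InsertAtCut-dec (b ≤?_) (UpSetOnTop-dec (b ≤?_) (R? zero)) (𝓢.R? zero)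
  R′? (suc i) = InsertAtCut-dec (λ y → ¬? (R? i y a)) (R? i) (𝓢.R? zero)

  linear′ : ∀ i → IsLinearExtension (adj L₁ a b L₂) (R′ i)
  linear′ zero = InsertAtCut-isLinearExtension (b ≤?_)
    (UpSetOnTop-isLinearExtension (b ≤?_) (linear zero) (≤-upClosed b))
    (𝓢.linear zero) UpSetOnTop-upClosed
    (R-irreflexive zero a<b ∘ extends (linear zero) b a) (≤-reflexive b)
  linear′ (suc i) = InsertAtCut-isLinearExtension (λ y → ¬? (R? i y a))
    (linear i) (𝓢.linear zero)
    (λ x y Rxy ¬Rxa Rya → ¬Rxa (trans (linear i) x y a Rxy Rya))
    (λ ¬Raa → ¬Raa (refl (linear i) a)) (R-irreflexive i a<b)

  reflects′ : ∀ x y → (∀ i → R′ i x y) → _≤_ (adj L₁ a b L₂) x y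
  reflects′ (inj₁ x) (inj₁ y) h = reflects x y (h ∘ suc)
  reflects′ (inj₂ c) (inj₂ d) h = 𝓢.reflects c d λ { zero → h zero }
  reflects′ (inj₁ x) (inj₂ c) h = reflects x a λ i → decidable-stable (R? i x a) (h (suc i))
  reflects′ (inj₂ c) (inj₁ y) h = h zero

iterChainSumDecRealizer : ∀ {k L} → IterChainSum k L → DecRealizer L (suc k)
iterChainSumDecRealizer (base n)              = chainDecRealizer n
iterChainSumDecRealizer (step I a b a<b _ m) =
  adjDecRealizer (iterChainSumDecRealizer I) a<b (chainDecRealizer m)

mainTheorem9 : (k : ℕ) (L : Order) → IterChainSum k L → DimLE L (suc k)
mainTheorem9 k L I = suc k , ≤-refl , DecRealizer.realizer (iterChainSumDecRealizer I)
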